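{- Let $F$ and $g$ be positive integers such that $g \leq F \leq 2g-1$. Then the quotient set $\mathcal{S}(F,g)/R = \{[S] : S \in \mathcal{S}(F,g)\}$ equals $\{[S] : S \in \mathcal{E}(F,g)\}$. Furthermore, if $S, S' \in \mathcal{E}(F,g)$ and $S \neq S'$, then $[S] \cap [S'] = \emptyset$.
   Context: A numerical semigroup is a subset $S \subseteq \mathbb{N}$ (with $\mathbb{N}$ the nonnegative integers) closed under addition, containing $0$, with $\mathbb{N}\setminus S$ finite. The genus of $S$ is $\#(\mathbb{N}\setminus S)$; the Frobenius number $\mathrm{F}(S)$ is the largest integer not in $S$; the multiplicity $\mathrm{m}(S)$ is the least positive integer in $S$. $S$ is called elementary if $\mathrm{F}(S) < 2\,\mathrm{m}(S)$. $\mathcal{S}(F,g)$ denotes the set of numerical semigroups with Frobenius number $F$ and genus $g$, and $\mathcal{E}(F,g)$ the set of elementary numerical semigroups with Frobenius number $F$ and genus $g$. For $S \in \mathcal{S}(F,g)$ define $\theta(S) = \left(S \setminus \{x \in S\setminus\{0\} : x < \frac{F}{2}\}\right) \cup \{F - x : x \in S\setminus\{0\},\ x < \frac{F}{2}\}$. The equivalence relation $R$ on $\mathcal{S}(F,g)$ is given by $S R S'$ iff $\theta(S) = \theta(S')$, and $[S] = \{S' \in \mathcal{S}(F,g) : S R S'\}$. -}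

module Defs where

open import Data.Nat using (ℕ; zero; suc; _+_; _*_; _∸_; _≤_; _<_)
open import Data.Bool using (Bool; true; false; not)
open import Data.List using (List; length; filterᵇ; upTo)
open import Data.Product using (Σ; _×_; ∃-syntax)
open import Data.Sum using (_⊎_)
open import Relation.Nullary using (¬_)
open import Relation.Binary.PropositionalEquality using (_≡_)
open import Function.Bundles using (_⇔_)

Subsetℕ : Set
Subsetℕ = ℕ → Bool

_∈_ : ℕ → Subsetℕ → Set
n ∈ S = S n ≡ true

_∉_ : ℕ → Subsetℕ → Set
n ∉ S = S n ≡ false

record IsNumericalSemigroup (S : Subsetℕ) : Set where
  field
    zero∈   : 0 ∈ S
    closed  : ∀ x y → x ∈ S → y ∈ S → (x + y) ∈ S
    cofinite : ∃[ N ] (∀ n → N ≤ n → n ∈ S)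

IsFrobenius : Subsetℕ → ℕ → Set
IsFrobenius S F = F ∉ S × (∀ n → F < n → n ∈ S)

gapsUpTo : Subsetℕ → ℕ → ℕ
gapsUpTo S N = length (filterᵇ (λ n → not (S n)) (upTo (suc N)))

-- g is the genus of S, i.e. #(ℕ \ S) = g (every gap is ≤ F(S))
HasGenus : Subsetℕ → ℕ → Set
HasGenus S g = Σ ℕ (λ F → IsFrobenius S F × gapsUpTo S F ≡ g)

IsMultiplicity : Subsetℕ → ℕ → Set
IsMultiplicity S m = 0 < m × m ∈ S × (∀ x → 0 < x → x < m → x ∉ S)

InSFg : ℕ → ℕ → Subsetℕ → Set
InSFg F g S = IsNumericalSemigroup S × IsFrobenius S F × HasGenus S g

IsElementary : ℕ → Subsetℕ → Set
IsElementary F S = Σ ℕ (λ m → IsMultiplicity S m × F < 2 * m)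

InEFg : ℕ → ℕ → Subsetℕ → Set
InEFg F g S = InSFg F g S × IsElementary F S

-- θ(S) (for the Frobenius number F), as a predicate on ℕ;  "x < F/2" is "2x < F"
θ : ℕ → Subsetℕ → ℕ → Set
θ F S n =
  (n ∈ S × ¬ (0 < n × 2 * n < F))
  ⊎ (n ≤ F × 0 < F ∸ n × 2 * (F ∸ n) < F × (F ∸ n) ∈ S)

R : ℕ → Subsetℕ → Subsetℕ → Set
R F S S' = ∀ n → θ F S n ⇔ θ F S' n

_≐_ : Subsetℕ → Subsetℕ → Set
S ≐ S' = ∀ n → S n ≡ S' n

module Submission where

-- θ(S) moves every small element x of S (0 < x and 2x < F) to its mirror image F − x.
-- Every nonzero element of θ(S) exceeds F/2, so θ(S) is automatically a numerical
-- semigroup with Frobenius number F, and it is elementary.  Its genus is that of S: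
-- since F ∉ S, at most one element of each mirror pair {x, F − x} lies in S, and θ
-- keeps the number of gaps on each pair, so the gap counts agree after summing over
-- the pairs (the sum over all x counts every gap twice).  Finally θ is the identity
-- on elementary semigroups; hence θ(θ(S)) = θ(S), i.e. S R θ(S), and an R-class
-- contains at most one elementary semigroup.

open import Defs
open import Data.Nat using (ℕ; _≤_; _<_; _*_)
open import Data.Product using (Σ; _×_)
open import Relation.Nullary using (¬_)
open import Function.Bundles using (_⇔_)

open import Data.Nat using (zero; suc; z<s; s<s; s≤s⁻¹; _+_; _∸_; _<?_; ⌊_/2⌋)
open import Data.Nat.Properties
open import Algebra.Properties.CommutativeSemigroup +-commutativeSemigroup using (interchange)
open import Data.Bool using (Bool; true; false; not; _∨_)
open import Data.Bool.Properties using (∨-zeroʳ; ¬-not; not-¬)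
open import Data.List using (length; filterᵇ; applyUpTo)
open import Data.Product using (_,_; proj₁; proj₂; ∃-syntax)
open import Data.Sum using (_⊎_; inj₁; inj₂)
open import Data.Empty using (⊥; ⊥-elim)
open import Function.Base using (_∘_; flip)
open import Function.Bundles using (mk⇔; Equivalence)
open import Function.Properties.Equivalence using () renaming (refl to ⇔-refl; sym to ⇔-sym; trans to ⇔-trans)
open import Relation.Nullary using (Dec; yes; no)
open import Relation.Nullary.Decidable using (_×-dec_)
open import Relation.Binary.PropositionalEquality
open import Relation.Binary.Definitions using (tri<; tri≈; tri>)

sumBelow : (ℕ → ℕ) → ℕ → ℕ
sumBelow f zero    = 0
sumBelow f (suc n) = f 0 + sumBelow (f ∘ suc) n

sumBelow-cong : ∀ {f h} n → (∀ i → i < n → f i ≡ h i) → sumBelow f n ≡ sumBelow h n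
sumBelow-cong zero    f≡h = refl
sumBelow-cong (suc n) f≡h =
  cong₂ _+_ (f≡h 0 z<s) (sumBelow-cong n (λ i i<n → f≡h (suc i) (s<s i<n)))

sumBelow-+ : ∀ f h n → sumBelow (λ i → f i + h i) n ≡ sumBelow f n + sumBelow h n
sumBelow-+ f h zero    = refl
sumBelow-+ f h (suc n) =
  trans (cong (f 0 + h 0 +_) (sumBelow-+ (f ∘ suc) (h ∘ suc) n)) (interchange (f 0) (h 0) _ _)

sumBelow-suc : ∀ f n → sumBelow f (suc n) ≡ sumBelow f n + f n
sumBelow-suc f zero    = +-comm (f 0) 0
sumBelow-suc f (suc n) =
  trans (cong (f 0 +_) (sumBelow-suc (f ∘ suc) n)) (sym (+-assoc (f 0) _ _))

sumBelow-reflect : ∀ f N → sumBelow (λ i → f (N ∸ i)) (suc N) ≡ sumBelow f (suc N)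
sumBelow-reflect f zero    = refl
sumBelow-reflect f (suc N) = begin
  f (suc N) + sumBelow (λ i → f (N ∸ i)) (suc N) ≡⟨ cong (f (suc N) +_) (sumBelow-reflect f N) ⟩
  f (suc N) + sumBelow f (suc N)                 ≡⟨ +-comm (f (suc N)) _ ⟩
  sumBelow f (suc N) + f (suc N)                 ≡⟨ sumBelow-suc f (suc N) ⟨
  sumBelow f (suc (suc N))                       ∎
  where open ≡-Reasoning

-- Each pair {i, N ∸ i} is counted twice on either side, hence the halving.
sumBelow-cong-mirror : ∀ {f h} N → (∀ i → i ≤ N → f i + f (N ∸ i) ≡ h i + h (N ∸ i)) →
                       sumBelow f (suc N) ≡ sumBelow h (suc N)
sumBelow-cong-mirror {f} {h} N pairs≡ = begin
  sumBelow f (suc N)                       ≡⟨ n≡⌊n+n/2⌋ _ ⟩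
  ⌊ double f /2⌋                           ≡⟨ cong ⌊_/2⌋ (double-≡ f) ⟩
  ⌊ sumBelow (pairSum f) (suc N) /2⌋      ≡⟨ cong ⌊_/2⌋ (sumBelow-cong (suc N) (λ i i≤N → pairs≡ i (s≤s⁻¹ i≤N))) ⟩
  ⌊ sumBelow (pairSum h) (suc N) /2⌋      ≡⟨ cong ⌊_/2⌋ (double-≡ h) ⟨
  ⌊ double h /2⌋                           ≡⟨ n≡⌊n+n/2⌋ _ ⟨
  sumBelow h (suc N)                       ∎
  where
    open ≡-Reasoning
    pairSum : (ℕ → ℕ) → ℕ → ℕ
    pairSum k i = k i + k (N ∸ i)
    double : (ℕ → ℕ) → ℕ
    double k = sumBelow k (suc N) + sumBelow k (suc N)
    double-≡ : ∀ k → double k ≡ sumBelow (pairSum k) (suc N)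
    double-≡ k = trans (cong (sumBelow k (suc N) +_) (sym (sumBelow-reflect k N)))
                       (sym (sumBelow-+ k (λ i → k (N ∸ i)) (suc N)))

isGap : Bool → ℕ
isGap true  = 0
isGap false = 1

length-filter-gaps : ∀ (S : Subsetℕ) f n →
  length (filterᵇ (λ i → not (S i)) (applyUpTo f n)) ≡ sumBelow (λ i → isGap (S (f i))) n
length-filter-gaps S f zero = refl
length-filter-gaps S f (suc n) with S (f 0)
... | true  = length-filter-gaps S (f ∘ suc) n
... | false = cong suc (length-filter-gaps S (f ∘ suc) n)

gapsUpTo≡sumBelow : ∀ S N → gapsUpTo S N ≡ sumBelow (isGap ∘ S) (suc N)
gapsUpTo≡sumBelow S N = length-filter-gaps S (λ i → i) (suc N)

isGap-∨ : ∀ a b → (a ≡ true → b ≡ true → ⊥) → isGap (a ∨ b) + 1 ≡ isGap a + isGap b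
isGap-∨ true  true  ¬both = ⊥-elim (¬both refl refl)
isGap-∨ true  false _     = refl
isGap-∨ false true  _     = refl
isGap-∨ false false _     = refl

isFrobenius-unique : ∀ {S F F′} → IsFrobenius S F → IsFrobenius S F′ → F ≡ F′
isFrobenius-unique {F = F} {F′} (F∉S , >F∈S) (F′∉S , >F′∈S) with <-cmp F F′
... | tri< F<F′ _ _ = ⊥-elim (not-¬ (>F∈S F′ F<F′) F′∉S)
... | tri≈ _ F≡F′ _ = F≡F′
... | tri> _ _ F′<F = ⊥-elim (not-¬ (>F′∈S F F′<F) F∉S)

NoPositiveBelow : Subsetℕ → ℕ → Set
NoPositiveBelow S N = ∀ x → 0 < x → x < N → x ∉ S

noPositiveBelow-suc : ∀ {S N} → NoPositiveBelow S N → (0 < N → N ∉ S) → NoPositiveBelow S (suc N)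
noPositiveBelow-suc {N = N} none N∉S x 0<x x<1+N with m<1+n⇒m<n∨m≡n x<1+N
... | inj₁ x<N  = none x 0<x x<N
... | inj₂ refl = N∉S 0<x

multiplicity-search : ∀ S N → NoPositiveBelow S N ⊎ ∃[ m ] IsMultiplicity S m
multiplicity-search S zero = inj₁ (λ _ _ ())
multiplicity-search S (suc N) with multiplicity-search S N
... | inj₂ found = inj₂ found
... | inj₁ none with 0 <? N | S N in N∈S?
...   | yes 0<N | true  = inj₂ (N , 0<N , N∈S? , none)
...   | yes _   | false = inj₁ (noPositiveBelow-suc none (λ _ → N∈S?))
...   | no 0≮N  | _     = inj₁ (noPositiveBelow-suc none (⊥-elim ∘ 0≮N))

multiplicity-exists : ∀ S {n} → 0 < n → n ∈ S → ∃[ m ] IsMultiplicity S m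
multiplicity-exists S {n} 0<n n∈S with multiplicity-search S (suc n)
... | inj₂ found = found
... | inj₁ none  = ⊥-elim (not-¬ n∈S (none n 0<n (n<1+n n)))

Small : ℕ → ℕ → Set
Small F x = 0 < x × 2 * x < F

small? : ∀ F x → Dec (Small F x)
small? F x = 0 <? x ×-dec 2 * x <? F

2*-+ : ∀ x → 2 * x ≡ x + x
2*-+ x = cong (x +_) (+-identityʳ x)

mirror-small⇒large : ∀ {F x} → x ≤ F → 2 * (F ∸ x) < F → F < 2 * x
mirror-small⇒large {F} {x} x≤F small = +-cancelʳ-< (2 * (F ∸ x)) F (2 * x) (begin-strict
  F + 2 * (F ∸ x)      <⟨ +-monoʳ-< F small ⟩
  F + F                ≡⟨ 2*-+ F ⟨
  2 * F                ≡⟨ cong (2 *_) (m+[n∸m]≡n x≤F) ⟨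
  2 * (x + (F ∸ x))    ≡⟨ *-distribˡ-+ 2 x (F ∸ x) ⟩
  2 * x + 2 * (F ∸ x)  ∎)
  where open ≤-Reasoning

¬small∧mirror-small : ∀ {F x} → x ≤ F → Small F x → ¬ Small F (F ∸ x)
¬small∧mirror-small x≤F (_ , 2x<F) (_ , 2[F∸x]<F) = <-asym 2x<F (mirror-small⇒large x≤F 2[F∸x]<F)

small⇒mirror-mirror-small : ∀ {F x} → x ≤ F → Small F x → Small F (F ∸ (F ∸ x))
small⇒mirror-mirror-small x≤F = subst (Small _) (sym (m∸[m∸n]≡n x≤F))

mirror-pos⇒≤ : ∀ {F x} → 0 < F ∸ x → x ≤ F
mirror-pos⇒≤ pos = <⇒≤ (m∸n≢0⇒n<m (>⇒≢ pos))

-- A small n is never in θ(S), because then F ∸ n is not small.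
θᵇ : ℕ → Subsetℕ → Subsetℕ
θᵇ F S n with small? F n | small? F (F ∸ n)
... | yes _ | _     = false
... | no _  | yes _ = S n ∨ S (F ∸ n)
... | no _  | no _  = S n

module _ (F : ℕ) (S : Subsetℕ) {n : ℕ} where

  θᵇ-small : Small F n → θᵇ F S n ≡ false
  θᵇ-small small with small? F n
  ... | yes _      = refl
  ... | no ¬small = ⊥-elim (¬small small)

  θᵇ-mirror-small : ¬ Small F n → Small F (F ∸ n) → θᵇ F S n ≡ S n ∨ S (F ∸ n)
  θᵇ-mirror-small ¬small small′ with small? F n | small? F (F ∸ n)
  ... | yes small | _          = ⊥-elim (¬small small)
  ... | no _      | yes _      = refl
  ... | no _      | no ¬small′ = ⊥-elim (¬small′ small′)

  θᵇ-not-small : ¬ Small F n → ¬ Small F (F ∸ n) → θᵇ F S n ≡ S n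
  θᵇ-not-small ¬small ¬small′ with small? F n | small? F (F ∸ n)
  ... | yes small | _           = ⊥-elim (¬small small)
  ... | no _      | yes small′ = ⊥-elim (¬small′ small′)
  ... | no _      | no _        = refl

  θ⇔θᵇ : θ F S n ⇔ n ∈ θᵇ F S
  θ⇔θᵇ with small? F n | small? F (F ∸ n)
  ... | yes small | _ = mk⇔ to λ ()
    where
      to : θ F S n → false ≡ true
      to (inj₁ (_ , ¬small))                  = ⊥-elim (¬small small)
      to (inj₂ (n≤F , small′₀ , small′₁ , _)) =
        ⊥-elim (¬small∧mirror-small n≤F small (small′₀ , small′₁))
  ... | no ¬small | yes small′ = mk⇔ to from
    where
      to : θ F S n → S n ∨ S (F ∸ n) ≡ true
      to (inj₁ (n∈S , _)) rewrite n∈S = refl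
      to (inj₂ (_ , _ , _ , F∸n∈S)) rewrite F∸n∈S = ∨-zeroʳ (S n)
      from : S n ∨ S (F ∸ n) ≡ true → θ F S n
      from n∈θ with S n
      ... | true  = inj₁ (refl , ¬small)
      ... | false = inj₂ (mirror-pos⇒≤ (proj₁ small′) , proj₁ small′ , proj₂ small′ , n∈θ)
  ... | no ¬small | no ¬small′ = mk⇔ to from
    where
      to : θ F S n → n ∈ S
      to (inj₁ (n∈S , _))                   = n∈S
      to (inj₂ (_ , small′₀ , small′₁ , _)) = ⊥-elim (¬small′ (small′₀ , small′₁))
      from : n ∈ S → θ F S n
      from n∈S = inj₁ (n∈S , ¬small)

θ-zero : ∀ {F} S → 0 ∈ S → θ F S 0
θ-zero _ 0∈S = inj₁ (0∈S , λ ())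

θ-above : ∀ {F n} S → F < n → n ∈ S → θ F S n
θ-above {n = n} _ F<n n∈S = inj₁ (n∈S , λ (_ , 2n<F) → <-asym F<n (≤-<-trans (m≤n*m n 2) 2n<F))

¬θ-Frobenius : ∀ {F} S → F ∉ S → ¬ θ F S F
¬θ-Frobenius _ F∉S (inj₁ (F∈S , _))        = not-¬ F∈S F∉S
¬θ-Frobenius {F} _ _ (inj₂ (_ , 0<F∸F , _)) = <-irrefl (sym (n∸n≡0 F)) 0<F∸F

θ-elementary : ∀ {F S} → IsElementary F S → ∀ n → θ F S n ⇔ n ∈ S
θ-elementary {F} {S} (m , (_ , _ , none) , F<2m) n = mk⇔ to from
  where
    ¬small : ∀ {x} → x ∈ S → ¬ Small F x
    ¬small x∈S (0<x , 2x<F) =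
      <-asym F<2m (≤-<-trans (*-monoʳ-≤ 2 (≮⇒≥ (not-¬ x∈S ∘ none _ 0<x))) 2x<F)
    to : θ F S n → n ∈ S
    to (inj₁ (n∈S , _))                       = n∈S
    to (inj₂ (_ , 0<F∸n , 2[F∸n]<F , F∸n∈S)) = ⊥-elim (¬small F∸n∈S (0<F∸n , 2[F∸n]<F))
    from : n ∈ S → θ F S n
    from n∈S = inj₁ (n∈S , ¬small n∈S)

module _ {F : ℕ} {S : Subsetℕ} (ns : IsNumericalSemigroup S) (F∉S : F ∉ S) where
  open IsNumericalSemigroup ns

  ¬mirror-pair-∈ : ∀ {x} → x ≤ F → x ∈ S → (F ∸ x) ∈ S → ⊥
  ¬mirror-pair-∈ x≤F x∈S F∸x∈S =
    not-¬ (subst (_∈ S) (m+[n∸m]≡n x≤F) (closed _ _ x∈S F∸x∈S)) F∉S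

  θ-large : ∀ {x} → θ F S x → 0 < x → F < 2 * x
  θ-large {x} (inj₁ (x∈S , ¬small)) 0<x = ≤∧≢⇒< (≮⇒≥ (¬small ∘ (0<x ,_))) F≢2x
    where
      F≢2x : F ≢ 2 * x
      F≢2x F≡2x = not-¬ (subst (_∈ S) (trans (sym (2*-+ x)) (sym F≡2x)) (closed x x x∈S x∈S)) F∉S
  θ-large (inj₂ (x≤F , _ , small′ , _)) _ = mirror-small⇒large x≤F small′

module _ {F : ℕ} {S : Subsetℕ} (ns : IsNumericalSemigroup S) (fr : IsFrobenius S F) where
  open IsNumericalSemigroup ns
  private
    F∉S = proj₁ fr

  θᵇ-above : ∀ {n} → F < n → n ∈ θᵇ F S
  θᵇ-above F<n = Equivalence.to (θ⇔θᵇ F S) (θ-above S F<n (proj₂ fr _ F<n))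

  θᵇ-large : ∀ {x} → x ∈ θᵇ F S → 0 < x → F < 2 * x
  θᵇ-large x∈θ = θ-large ns F∉S (Equivalence.from (θ⇔θᵇ F S) x∈θ)

  θᵇ-isNumericalSemigroup : IsNumericalSemigroup (θᵇ F S)
  θᵇ-isNumericalSemigroup = record
    { zero∈    = Equivalence.to (θ⇔θᵇ F S) (θ-zero S zero∈)
    ; closed   = closedθ
    ; cofinite = suc F , λ _ → θᵇ-above
    }
    where
      closedθ : ∀ x y → x ∈ θᵇ F S → y ∈ θᵇ F S → (x + y) ∈ θᵇ F S
      closedθ zero    y       _   y∈θ = y∈θ
      closedθ (suc x) zero    x∈θ _   = subst (_∈ θᵇ F S) (sym (+-identityʳ (suc x))) x∈θ
      closedθ (suc x) (suc y) x∈θ y∈θ =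
        θᵇ-above (*-cancelˡ-< 2 F (suc x + suc y) (begin-strict
          2 * F                     ≡⟨ 2*-+ F ⟩
          F + F                     <⟨ +-mono-< (θᵇ-large x∈θ z<s) (θᵇ-large y∈θ z<s) ⟩
          2 * suc x + 2 * suc y     ≡⟨ *-distribˡ-+ 2 (suc x) (suc y) ⟨
          2 * (suc x + suc y)       ∎))
        where open ≤-Reasoning

  θᵇ-isFrobenius : IsFrobenius (θᵇ F S) F
  θᵇ-isFrobenius = ¬-not (¬θ-Frobenius S F∉S ∘ Equivalence.from (θ⇔θᵇ F S)) , λ _ → θᵇ-above

  θᵇ-mirror-gaps : ∀ {x} → x ≤ F →
    isGap (θᵇ F S x) + isGap (θᵇ F S (F ∸ x)) ≡ isGap (S x) + isGap (S (F ∸ x))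
  θᵇ-mirror-gaps {x} x≤F = by-cases (small? F x) (small? F (F ∸ x))
    where
      ¬both : S x ≡ true → S (F ∸ x) ≡ true → ⊥
      ¬both = ¬mirror-pair-∈ ns F∉S x≤F
      by-cases : Dec (Small F x) → Dec (Small F (F ∸ x)) →
        isGap (θᵇ F S x) + isGap (θᵇ F S (F ∸ x)) ≡ isGap (S x) + isGap (S (F ∸ x))
      by-cases (yes small) _
        rewrite θᵇ-small F S small
              | θᵇ-mirror-small F S (¬small∧mirror-small x≤F small) (small⇒mirror-mirror-small x≤F small)
              | m∸[m∸n]≡n x≤F
              = trans (+-comm 1 _) (trans (isGap-∨ (S (F ∸ x)) (S x) (flip ¬both))
                                      (+-comm (isGap (S (F ∸ x))) (isGap (S x))))
      by-cases (no ¬small) (yes small′)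
        rewrite θᵇ-mirror-small F S ¬small small′
              | θᵇ-small F S small′
              = isGap-∨ _ _ ¬both
      by-cases (no ¬small) (no ¬small′)
        rewrite θᵇ-not-small F S ¬small ¬small′
              | θᵇ-not-small F S ¬small′ (¬small ∘ subst (Small F) (m∸[m∸n]≡n x≤F))
              = refl

  θᵇ-gapsUpTo : gapsUpTo (θᵇ F S) F ≡ gapsUpTo S F
  θᵇ-gapsUpTo = begin
    gapsUpTo (θᵇ F S) F                 ≡⟨ gapsUpTo≡sumBelow (θᵇ F S) F ⟩
    sumBelow (isGap ∘ θᵇ F S) (suc F)   ≡⟨ sumBelow-cong-mirror {f = isGap ∘ θᵇ F S} {h = isGap ∘ S} F
                                             (λ _ → θᵇ-mirror-gaps) ⟩
    sumBelow (isGap ∘ S) (suc F)        ≡⟨ gapsUpTo≡sumBelow S F ⟨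
    gapsUpTo S F                        ∎
    where open ≡-Reasoning

  θᵇ-isElementary : IsElementary F (θᵇ F S)
  θᵇ-isElementary =
    let m , mult = multiplicity-exists (θᵇ F S) z<s (θᵇ-above (n<1+n F))
    in  m , mult , θᵇ-large (proj₁ (proj₂ mult)) (proj₁ mult)

θᵇ-inEFg : ∀ {F g S} → InSFg F g S → InEFg F g (θᵇ F S)
θᵇ-inEFg {F} {g} {S} (ns , fr , F′ , fr′ , gapsS≡g) =
  (θᵇ-isNumericalSemigroup ns fr , θᵇ-isFrobenius ns fr , F , θᵇ-isFrobenius ns fr , gapsθ≡g)
  , θᵇ-isElementary ns fr
  where
    gapsθ≡g : gapsUpTo (θᵇ F S) F ≡ g
    gapsθ≡g = trans (θᵇ-gapsUpTo ns fr) (subst (λ G → gapsUpTo S G ≡ g) (isFrobenius-unique fr′ fr) gapsS≡g)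

R-θᵇ : ∀ {F g S} → InSFg F g S → R F S (θᵇ F S)
R-θᵇ {F} {S = S} S∈𝒮 n = ⇔-trans (θ⇔θᵇ F S) (⇔-sym (θ-elementary (proj₂ (θᵇ-inEFg S∈𝒮)) n))

R-respʳ : ∀ {F T S S′} → R F S S′ → R F T S ⇔ R F T S′
R-respʳ S~S′ = mk⇔ (λ T~S n → ⇔-trans (T~S n) (S~S′ n)) (λ T~S′ n → ⇔-trans (T~S′ n) (⇔-sym (S~S′ n)))

≡true-injective : ∀ {a b} → (a ≡ true ⇔ b ≡ true) → a ≡ b
≡true-injective {true}          a⇔b = sym (Equivalence.to a⇔b refl)
≡true-injective {false} {false} _   = refl
≡true-injective {false} {true}  a⇔b = Equivalence.from a⇔b refl

elementary-R-unique : ∀ {F S S′ T} → IsElementary F S → IsElementary F S′ → R F T S → R F T S′ → S ≐ S′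
elementary-R-unique S-elem S′-elem T~S T~S′ n = ≡true-injective
  (⇔-trans (⇔-sym (θ-elementary S-elem n)) (⇔-trans (⇔-sym (T~S n)) (⇔-trans (T~S′ n) (θ-elementary S′-elem n))))

corollary7 : (F g : ℕ) → 0 < F → 0 < g → g ≤ F → F < 2 * g →
    ((S : Subsetℕ) → InSFg F g S →
        Σ Subsetℕ (λ S' → InEFg F g S' × ((T : Subsetℕ) → InSFg F g T → (R F T S ⇔ R F T S'))))
    × ((S : Subsetℕ) → InEFg F g S →
        Σ Subsetℕ (λ S' → InSFg F g S' × ((T : Subsetℕ) → InSFg F g T → (R F T S ⇔ R F T S'))))
    × ((S S' : Subsetℕ) → InEFg F g S → InEFg F g S' → ¬ (S ≐ S') →
        ¬ Σ Subsetℕ (λ T → InSFg F g T × R F T S × R F T S'))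
corollary7 F g _ _ _ _ =
    (λ S S∈𝒮 → θᵇ F S , θᵇ-inEFg S∈𝒮 , λ _ _ → R-respʳ (R-θᵇ S∈𝒮))
  , (λ S S∈ℰ → S , proj₁ S∈ℰ , λ _ _ → ⇔-refl)
  , λ _ _ (_ , S-elem) (_ , S′-elem) S≠S′ (_ , _ , T~S , T~S′) →
      S≠S′ (elementary-R-unique S-elem S′-elem T~S T~S′)
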